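{- For every positive integer $m$, $$\nu_2\left( \sum_{k=0}^m 2^k \binom{2m-2k}{m-k}\binom{m+k}{m} \right) = m - \nu_2(m!) = s_2(m).$$
   Context: $\nu_2$ denotes the $2$-adic valuation of a nonzero rational number, and $s_2(m)$ is the sum of the binary digits of $m$. -}

module Defs where

open import Data.Nat using (ℕ; zero; suc; _+_; _*_; _∸_; _^_; _/_; _%_)
open import Data.Nat.Divisibility using (_∣_)
open import Data.Nat.Combinatorics using (_C_)
open import Data.Product using (_×_)
open import Relation.Nullary using (¬_)

-- 2-adic valuation, as a relation: "ν₂(n) = v" for a natural number n.
-- For n > 0 it is the unique v with 2^v ∣ n and ¬ 2^(v+1) ∣ n.
ν₂≡ : ℕ → ℕ → Set
ν₂≡ n v = (2 ^ v ∣ n) × ¬ (2 ^ suc v ∣ n)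

-- binary digit sum, computed with fuel; fuel n suffices (n halves each step)
s₂-fuel : ℕ → ℕ → ℕ
s₂-fuel zero    n = 0
s₂-fuel (suc f) n = n % 2 + s₂-fuel f (n / 2)

s₂ : ℕ → ℕ
s₂ m = s₂-fuel m m

sumTo : ℕ → (ℕ → ℕ) → ℕ
sumTo zero    f = f 0
sumTo (suc m) f = sumTo m f + f (suc m)

S : ℕ → ℕ
S m = sumTo m (λ k → 2 ^ k * ((2 * m ∸ 2 * k) C (m ∸ k)) * ((m + k) C m))

-- Zeilberger's algorithm gives the recurrence (m + 1) S(m + 1) = 2 (4m + 3) S(m), proved here by
-- telescoping with the certificate G. As 4m + 3 is odd, m! S(m) is 2^m times an odd number, and
-- Legendre's formula ν₂(m!) = m − s₂(m) leaves ν₂(S(m)) = s₂(m).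
module Submission where

open import Defs
open import Data.Nat using (ℕ; _∸_; _≤_; _!)
open import Data.Product using (_×_; Σ)
open import Relation.Binary.PropositionalEquality using (_≡_)

open import Data.Nat
open import Data.Nat.Properties
open import Data.Nat.DivMod using (m≡m%n+[m/n]*n; m%n<n; m/n<m)
open import Data.Nat.Divisibility using (_∣_; divides; ∣-trans; _∣0)
open import Data.Nat.Combinatorics
  using (_C_; nCk+nC[k+1]≡[n+1]C[k+1]; nCk≡nC[n∸k]; nC1≡n; k>n⇒nCk≡0)
open import Data.Nat.Induction using (<-rec)
open import Data.Nat.Tactic.RingSolver using (solve-∀)
open import Data.Product using (∃-syntax; _,_)
open import Data.Sum using (_⊎_; inj₁; inj₂)
open import Data.Empty using (⊥-elim)
open import Relation.Nullary using (¬_)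
open import Relation.Binary.Definitions using (tri<; tri≈; tri>)
open import Relation.Binary.PropositionalEquality
  using (_≢_; refl; sym; trans; cong; cong₂; subst; module ≡-Reasoning)

[1+k]*[1+n]C[1+k]≡[1+n]*nCk : ∀ n k → suc k * (suc n C suc k) ≡ suc n * (n C k)
[1+k]*[1+n]C[1+k]≡[1+n]*nCk zero    zero    = refl
[1+k]*[1+n]C[1+k]≡[1+n]*nCk zero    (suc k) = *-zeroʳ (suc (suc k))
[1+k]*[1+n]C[1+k]≡[1+n]*nCk (suc n) zero    =
  trans (*-identityˡ _) (trans (nC1≡n (suc (suc n))) (sym (*-identityʳ _)))
[1+k]*[1+n]C[1+k]≡[1+n]*nCk (suc n) (suc k) = begin
  suc (suc k) * (suc (suc n) C suc (suc k))
    ≡⟨ cong (suc (suc k) *_) (sym (nCk+nC[k+1]≡[n+1]C[k+1] (suc n) (suc k))) ⟩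
  suc (suc k) * (X + Y)
    ≡⟨ split k X Y ⟩
  suc k * X + X + suc (suc k) * Y
    ≡⟨ cong₂ (λ u v → u + X + v) ([1+k]*[1+n]C[1+k]≡[1+n]*nCk n k)
                                ([1+k]*[1+n]C[1+k]≡[1+n]*nCk n (suc k)) ⟩
  suc n * (n C k) + X + suc n * (n C suc k)
    ≡⟨ regroup n X (n C k) (n C suc k) ⟩
  suc n * (n C k + n C suc k) + X
    ≡⟨ cong (λ u → suc n * u + X) (nCk+nC[k+1]≡[n+1]C[k+1] n k) ⟩
  suc n * X + X
    ≡⟨ +-comm (suc n * X) X ⟩
  suc (suc n) * X ∎
  where
  open ≡-Reasoning
  X = suc n C suc k
  Y = suc n C suc (suc k)
  split : ∀ k X Y → suc (suc k) * (X + Y) ≡ suc k * X + X + suc (suc k) * Y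
  split = solve-∀
  regroup : ∀ n X a b → suc n * a + X + suc n * b ≡ suc n * (a + b) + X
  regroup = solve-∀

[1+r]*[r+k]C[1+r]≡k*[r+k]Cr : ∀ r k → suc r * ((r + k) C suc r) ≡ k * ((r + k) C r)
[1+r]*[r+k]C[1+r]≡k*[r+k]Cr r k = +-cancelʳ-≡ (suc r * B) _ _ (begin
  suc r * A + suc r * B   ≡⟨ sym (*-distribˡ-+ (suc r) A B) ⟩
  suc r * (A + B)         ≡⟨ cong (suc r *_) (+-comm A B) ⟩
  suc r * (B + A)         ≡⟨ cong (suc r *_) (nCk+nC[k+1]≡[n+1]C[k+1] (r + k) r) ⟩
  suc r * (suc (r + k) C suc r) ≡⟨ [1+k]*[1+n]C[1+k]≡[1+n]*nCk (r + k) r ⟩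
  suc (r + k) * B         ≡⟨ rearrange r k B ⟩
  k * B + suc r * B       ∎)
  where
  open ≡-Reasoning
  A = (r + k) C suc r
  B = (r + k) C r
  rearrange : ∀ r k B → suc (r + k) * B ≡ k * B + suc r * B
  rearrange = solve-∀

[1+2j]C[1+j]≡[1+2j]Cj : ∀ j → suc (2 * j) C suc j ≡ suc (2 * j) C j
[1+2j]C[1+j]≡[1+2j]Cj j = trans
  (nCk≡nC[n∸k] (s≤s (m≤m+n j (j + 0))))
  (cong (suc (2 * j) C_) (trans (m+n∸m≡n j (j + 0)) (+-identityʳ j)))

central : ℕ → ℕ
central j = (2 * j) C j

central-recurrence : ∀ j → suc j * central (suc j) ≡ 2 * suc (2 * j) * central j
central-recurrence j = begin
  suc j * ((2 * suc j) C suc j)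
    ≡⟨ cong (λ n → suc j * (n C suc j)) (double-suc j) ⟩
  suc j * (suc (suc (2 * j)) C suc j)
    ≡⟨ [1+k]*[1+n]C[1+k]≡[1+n]*nCk (suc (2 * j)) j ⟩
  suc (suc (2 * j)) * (suc (2 * j) C j)
    ≡⟨ pull-two j (suc (2 * j) C j) ⟩
  2 * (suc j * (suc (2 * j) C j))
    ≡⟨ cong (λ x → 2 * (suc j * x)) (sym ([1+2j]C[1+j]≡[1+2j]Cj j)) ⟩
  2 * (suc j * (suc (2 * j) C suc j))
    ≡⟨ cong (2 *_) ([1+k]*[1+n]C[1+k]≡[1+n]*nCk (2 * j) j) ⟩
  2 * (suc (2 * j) * central j)
    ≡⟨ sym (*-assoc 2 (suc (2 * j)) (central j)) ⟩
  2 * suc (2 * j) * central j ∎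
  where
  open ≡-Reasoning
  double-suc : ∀ j → 2 * suc j ≡ suc (suc (2 * j))
  double-suc = solve-∀
  pull-two : ∀ j x → suc (suc (2 * j)) * x ≡ 2 * (suc j * x)
  pull-two = solve-∀

sumTo-cong : ∀ n {f g : ℕ → ℕ} → (∀ k → k ≤ n → f k ≡ g k) → sumTo n f ≡ sumTo n g
sumTo-cong zero    f≗g = f≗g 0 z≤n
sumTo-cong (suc n) f≗g =
  cong₂ _+_ (sumTo-cong n (λ k k≤n → f≗g k (m≤n⇒m≤1+n k≤n))) (f≗g (suc n) ≤-refl)

sumTo-*ˡ : ∀ n c (f : ℕ → ℕ) → sumTo n (λ k → c * f k) ≡ c * sumTo n f
sumTo-*ˡ zero    c f = refl
sumTo-*ˡ (suc n) c f =
  trans (cong (_+ c * f (suc n)) (sumTo-*ˡ n c f)) (sym (*-distribˡ-+ c (sumTo n f) (f (suc n))))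

sumTo-telescope : ∀ n (a b h : ℕ → ℕ) → (∀ k → k ≤ n → a k + h (suc k) ≡ h k + b k) →
                  sumTo n a + h (suc n) ≡ h 0 + sumTo n b
sumTo-telescope zero    a b h step = step 0 z≤n
sumTo-telescope (suc n) a b h step = begin
  sumTo n a + a (suc n) + h (suc (suc n))   ≡⟨ +-assoc (sumTo n a) _ _ ⟩
  sumTo n a + (a (suc n) + h (suc (suc n))) ≡⟨ cong (sumTo n a +_) (step (suc n) ≤-refl) ⟩
  sumTo n a + (h (suc n) + b (suc n))       ≡⟨ sym (+-assoc (sumTo n a) _ _) ⟩
  sumTo n a + h (suc n) + b (suc n)
    ≡⟨ cong (_+ b (suc n)) (sumTo-telescope n a b h (λ k k≤n → step k (m≤n⇒m≤1+n k≤n))) ⟩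
  h 0 + sumTo n b + b (suc n)               ≡⟨ +-assoc (h 0) _ _ ⟩
  h 0 + (sumTo n b + b (suc n))             ∎
  where open ≡-Reasoning

F : ℕ → ℕ → ℕ
F m k = 2 ^ k * central (m ∸ k) * ((m + k) C m)

-- Zeilberger certificate: (m+1) F(m+1,k) − 2(4m+3) F(m,k) = G(m,k) − G(m,k+1).
G : ℕ → ℕ → ℕ
G m k = 2 * suc m * 2 ^ k * central (suc m ∸ k) * ((m + k) C suc m)

S≡sumTo-F : ∀ m → S m ≡ sumTo m (F m)
S≡sumTo-F m = sumTo-cong m (λ k _ →
  cong (λ n → 2 ^ k * (n C (m ∸ k)) * ((m + k) C m)) (sym (*-distribˡ-∸ 2 m k)))

-- Multiplied by 1 + j, it becomes a polynomial identity once (1 + j) c' and (1 + m) A are eliminated.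
certificate-algebra : ∀ {m} j k p c c' D A → m ≡ j + k →
  suc j * c' ≡ 2 * suc (2 * j) * c → suc m * A ≡ k * D →
  suc m * (p * c' * (D + A)) + 2 * suc m * (2 * p) * c * (D + A)
    ≡ 2 * suc m * p * c' * A + 2 * (3 + 4 * m) * (p * c * D)
certificate-algebra j k p c c' D A refl c'-rec A-rec = *-cancelˡ-≡ _ _ (suc j) (begin
  suc j * _             ≡⟨ expandˡ j k p c c' D A ⟩
  L (suc j * c')        ≡⟨ cong L c'-rec ⟩
  L c''                 ≡⟨ +-cancelʳ-≡ (2 * p * c * (k * D)) _ _ (begin
      L c'' + 2 * p * c * (k * D)             ≡⟨ balance j k p c D A ⟩
      R c'' + 2 * p * c * (suc (j + k) * A)   ≡⟨ cong (λ t → R c'' + 2 * p * c * t) A-rec ⟩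
      R c'' + 2 * p * c * (k * D)             ∎) ⟩
  R c''                 ≡⟨ cong R (sym c'-rec) ⟩
  R (suc j * c')        ≡⟨ sym (expandʳ j k p c c' D A) ⟩
  suc j * _             ∎)
  where
  open ≡-Reasoning
  c'' = 2 * suc (2 * j) * c
  L R : ℕ → ℕ
  L X = suc (j + k) * p * (D + A) * X + 2 * suc (j + k) * (2 * p) * c * (D + A) * suc j
  R X = 2 * suc (j + k) * p * A * X + 2 * (3 + 4 * (j + k)) * (p * c * D) * suc j
  expandˡ : ∀ j k p c c' D A →
    suc j * (suc (j + k) * (p * c' * (D + A)) + 2 * suc (j + k) * (2 * p) * c * (D + A))
      ≡ suc (j + k) * p * (D + A) * (suc j * c') + 2 * suc (j + k) * (2 * p) * c * (D + A) * suc j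
  expandˡ = solve-∀
  expandʳ : ∀ j k p c c' D A →
    suc j * (2 * suc (j + k) * p * c' * A + 2 * (3 + 4 * (j + k)) * (p * c * D))
      ≡ 2 * suc (j + k) * p * A * (suc j * c') + 2 * (3 + 4 * (j + k)) * (p * c * D) * suc j
  expandʳ = solve-∀
  balance : ∀ j k p c D A →
    suc (j + k) * p * (D + A) * (2 * suc (2 * j) * c) + 2 * suc (j + k) * (2 * p) * c * (D + A) * suc j
      + 2 * p * c * (k * D)
    ≡ 2 * suc (j + k) * p * A * (2 * suc (2 * j) * c) + 2 * (3 + 4 * (j + k)) * (p * c * D) * suc j
      + 2 * p * c * (suc (j + k) * A)
  balance = solve-∀

certificate : ∀ m k → k ≤ m →
  suc m * F (suc m) k + G m (suc k) ≡ G m k + 2 * (3 + 4 * m) * F m k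
certificate m k k≤m = begin
  suc m * (p * central (suc m ∸ k) * (suc (m + k) C suc m))
    + 2 * suc m * (2 * p) * c * ((m + suc k) C suc m)
    ≡⟨ cong₂ (λ u v → suc m * (p * central u * v) + 2 * suc m * (2 * p) * c * ((m + suc k) C suc m))
             1+m∸k≡1+j (sym (nCk+nC[k+1]≡[n+1]C[k+1] (m + k) m)) ⟩
  suc m * (p * c' * (D + A)) + 2 * suc m * (2 * p) * c * ((m + suc k) C suc m)
    ≡⟨ cong (λ u → suc m * (p * c' * (D + A)) + 2 * suc m * (2 * p) * c * u)
            (trans (cong (_C suc m) (+-suc m k)) (sym (nCk+nC[k+1]≡[n+1]C[k+1] (m + k) m))) ⟩
  suc m * (p * c' * (D + A)) + 2 * suc m * (2 * p) * c * (D + A)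
    ≡⟨ certificate-algebra j k p c c' D A (sym (m∸n+n≡m k≤m))
         (central-recurrence j) ([1+r]*[r+k]C[1+r]≡k*[r+k]Cr m k) ⟩
  2 * suc m * p * c' * A + 2 * (3 + 4 * m) * (p * c * D)
    ≡⟨ cong (λ u → 2 * suc m * p * central u * A + 2 * (3 + 4 * m) * (p * c * D)) (sym 1+m∸k≡1+j) ⟩
  G m k + 2 * (3 + 4 * m) * F m k ∎
  where
  open ≡-Reasoning
  j = m ∸ k
  p = 2 ^ k
  c = central j
  c' = central (suc j)
  D = (m + k) C m
  A = (m + k) C suc m
  1+m∸k≡1+j : suc m ∸ k ≡ suc j
  1+m∸k≡1+j = +-∸-assoc 1 k≤m

G-first : ∀ m → G m 0 ≡ 0
G-first m = trans
  (cong (λ n → 2 * suc m * 1 * central (suc m) * (n C suc m)) (+-identityʳ m))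
  (trans (cong (2 * suc m * 1 * central (suc m) *_) (k>n⇒nCk≡0 (n<1+n m)))
         (*-zeroʳ (2 * suc m * 1 * central (suc m))))

G-last : ∀ m → G m (suc m) ≡ suc m * F (suc m) (suc m)
G-last m = begin
  2 * suc m * p * c * E         ≡⟨ double m p c E ⟩
  suc m * (p * c * (E + E))     ≡⟨ cong (λ u → suc m * (p * c * (u + E))) E≡ ⟩
  suc m * (p * c * ((m + suc m) C m + E))
    ≡⟨ cong (λ u → suc m * (p * c * u)) (nCk+nC[k+1]≡[n+1]C[k+1] (m + suc m) m) ⟩
  suc m * F (suc m) (suc m)     ∎
  where
  open ≡-Reasoning
  p = 2 ^ suc m
  c = central (m ∸ m)
  E = (m + suc m) C suc m
  m+[1+m]≡1+2m : ∀ m → m + suc m ≡ suc (2 * m)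
  m+[1+m]≡1+2m = solve-∀
  E≡ : E ≡ (m + suc m) C m
  E≡ = subst (λ n → n C suc m ≡ n C m) (sym (m+[1+m]≡1+2m m)) ([1+2j]C[1+j]≡[1+2j]Cj m)
  double : ∀ a p c E → 2 * suc a * p * c * E ≡ suc a * (p * c * (E + E))
  double = solve-∀

S-recurrence : ∀ m → suc m * S (suc m) ≡ 2 * (3 + 4 * m) * S m
S-recurrence m = begin
  suc m * S (suc m)
    ≡⟨ cong (suc m *_) (S≡sumTo-F (suc m)) ⟩
  suc m * (sumTo m (F (suc m)) + F (suc m) (suc m))
    ≡⟨ *-distribˡ-+ (suc m) (sumTo m (F (suc m))) _ ⟩
  suc m * sumTo m (F (suc m)) + suc m * F (suc m) (suc m)
    ≡⟨ cong₂ _+_ (sym (sumTo-*ˡ m (suc m) (F (suc m)))) (sym (G-last m)) ⟩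
  sumTo m (λ k → suc m * F (suc m) k) + G m (suc m)
    ≡⟨ sumTo-telescope m _ _ (G m) (certificate m) ⟩
  G m 0 + sumTo m (λ k → 2 * (3 + 4 * m) * F m k)
    ≡⟨ cong₂ _+_ (G-first m) (sumTo-*ˡ m (2 * (3 + 4 * m)) (F m)) ⟩
  2 * (3 + 4 * m) * sumTo m (F m)
    ≡⟨ cong (2 * (3 + 4 * m) *_) (sym (S≡sumTo-F m)) ⟩
  2 * (3 + 4 * m) * S m ∎
  where open ≡-Reasoning

Odd : ℕ → Set
Odd o = ∃[ t ] o ≡ suc (t * 2)

infix 4 _≡2^_*odd
data _≡2^_*odd (n v : ℕ) : Set where
  oddPart : (o : ℕ) → Odd o → n ≡ 2 ^ v * o → n ≡2^ v *odd

odd-* : ∀ {a b} → Odd a → Odd b → Odd (a * b)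
odd-* (s , refl) (t , refl) = s + t + s * t * 2 , product s t
  where
  product : ∀ s t → suc (s * 2) * suc (t * 2) ≡ suc ((s + t + s * t * 2) * 2)
  product = solve-∀

odd≢2* : ∀ {o} → Odd o → ∀ x → o ≢ 2 * x
odd≢2* (t , refl) x o≡2x = even≢odd x t (trans (sym o≡2x) (cong suc (*-comm t 2)))

≡2^*odd-* : ∀ {a b v w} → a ≡2^ v *odd → b ≡2^ w *odd → a * b ≡2^ v + w *odd
≡2^*odd-* {v = v} {w} (oddPart o odd-o refl) (oddPart o' odd-o' refl) =
  oddPart (o * o') (odd-* odd-o odd-o') (begin
  2 ^ v * o * (2 ^ w * o')   ≡⟨ interchange (2 ^ v) o (2 ^ w) o' ⟩
  2 ^ v * 2 ^ w * (o * o')   ≡⟨ cong (_* (o * o')) (sym (^-distribˡ-+-* 2 v w)) ⟩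
  2 ^ (v + w) * (o * o')     ∎)
  where
  open ≡-Reasoning
  interchange : ∀ p o p' o' → p * o * (p' * o') ≡ p * p' * (o * o')
  interchange = solve-∀

≡2^*odd⇒ν₂≡ : ∀ {n v} → n ≡2^ v *odd → ν₂≡ n v
≡2^*odd⇒ν₂≡ {n} {v} (oddPart o odd-o n≡) = divides o (trans n≡ (*-comm (2 ^ v) o)) , not-2^[1+v]∣n
  where
  open ≡-Reasoning
  swap : ∀ q p → q * (2 * p) ≡ p * (2 * q)
  swap = solve-∀
  not-2^[1+v]∣n : ¬ (2 ^ suc v ∣ n)
  not-2^[1+v]∣n (divides q n≡q2^[1+v]) = odd≢2* odd-o q (*-cancelˡ-≡ _ _ (2 ^ v) {{m^n≢0 2 v}} (begin
    2 ^ v * o         ≡⟨ sym n≡ ⟩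
    n                 ≡⟨ n≡q2^[1+v] ⟩
    q * (2 * 2 ^ v)   ≡⟨ swap q (2 ^ v) ⟩
    2 ^ v * (2 * q)   ∎))

m^a∣m^b : ∀ m {a b} → a ≤ b → m ^ a ∣ m ^ b
m^a∣m^b m {a} {b} a≤b = divides (m ^ (b ∸ a))
  (trans (cong (m ^_) (sym (m∸n+n≡m a≤b))) (^-distribˡ-+-* m (b ∸ a) a))

ν₂≡-unique : ∀ {n v w} → ν₂≡ n v → ν₂≡ n w → v ≡ w
ν₂≡-unique {v = v} {w} (2^v∣n , 2^[1+v]∤n) (2^w∣n , 2^[1+w]∤n) with <-cmp v w
... | tri< v<w _ _ = ⊥-elim (2^[1+v]∤n (∣-trans (m^a∣m^b 2 v<w) 2^w∣n))
... | tri≈ _ v≡w _ = v≡w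
... | tri> _ _ w<v = ⊥-elim (2^[1+w]∤n (∣-trans (m^a∣m^b 2 w<v) 2^v∣n))

¬ν₂≡0 : ∀ {v} → ¬ ν₂≡ 0 v
¬ν₂≡0 (_ , 2^[1+v]∤0) = 2^[1+v]∤0 (_ ∣0)

≡0⊎≡2^*odd : ∀ n → n ≡ 0 ⊎ ∃[ v ] n ≡2^ v *odd
≡0⊎≡2^*odd = <-rec _ step
  where
  step : ∀ n → (∀ {m} → m < n → m ≡ 0 ⊎ ∃[ v ] m ≡2^ v *odd) → n ≡ 0 ⊎ ∃[ v ] n ≡2^ v *odd
  step zero    _   = inj₁ refl
  step (suc n) rec with suc n % 2 | suc n / 2 | m%n<n (suc n) 2 | m≡m%n+[m/n]*n (suc n) 2
                      | rec (m/n<m (suc n) 2 (s≤s (s≤s z≤n)))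
  ... | 0 | q | _ | ()  | inj₁ refl
  ... | 0 | q | _ | n≡q*2 | inj₂ (v , oddPart o odd-o q≡) =
    inj₂ (suc v , oddPart o odd-o (trans n≡q*2 (trans (cong (_* 2) q≡)
      (trans (*-comm (2 ^ v * o) 2) (sym (*-assoc 2 (2 ^ v) o))))))
  ... | 1 | q | _ | n≡1+q*2 | _ =
    inj₂ (0 , oddPart (suc n) (q , n≡1+q*2) (sym (*-identityˡ (suc n))))
  ... | suc (suc _) | _ | s≤s (s≤s ()) | _ | _

≡2^*odd-factorˡ : ∀ {a b n w} → a * b ≡2^ n *odd → b ≡2^ w *odd → ∃[ v ] a ≡2^ v *odd × v + w ≡ n
≡2^*odd-factorˡ {a} {n = n} ab b with ≡0⊎≡2^*odd a
... | inj₁ refl      = ⊥-elim (¬ν₂≡0 {n} (≡2^*odd⇒ν₂≡ ab))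
... | inj₂ (v , a≡) = v , a≡ , ν₂≡-unique (≡2^*odd⇒ν₂≡ (≡2^*odd-* a≡ b)) (≡2^*odd⇒ν₂≡ ab)

odd⇒≡2^0*odd : ∀ {o} → Odd o → o ≡2^ 0 *odd
odd⇒≡2^0*odd {o} odd-o = oddPart o odd-o (sym (*-identityˡ o))

[q*2]!≡2^q*odd*q! : ∀ q → ∃[ o ] Odd o × (q * 2) ! ≡ 2 ^ q * o * q !
[q*2]!≡2^q*odd*q! zero = 1 , (0 , refl) , refl
[q*2]!≡2^q*odd*q! (suc q) with [q*2]!≡2^q*odd*q! q
... | o , odd-o , eq = suc (q * 2) * o , odd-* (q , refl) odd-o , (begin
  suc (suc (q * 2)) * (suc (q * 2) * (q * 2) !)
    ≡⟨ cong (λ x → suc (suc (q * 2)) * (suc (q * 2) * x)) eq ⟩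
  suc (suc (q * 2)) * (suc (q * 2) * (2 ^ q * o * q !))
    ≡⟨ regroup q (2 ^ q) o (q !) ⟩
  2 * 2 ^ q * (suc (q * 2) * o) * (suc q * q !) ∎)
  where
  open ≡-Reasoning
  regroup : ∀ q p o f → suc (suc (q * 2)) * (suc (q * 2) * (p * o * f))
                        ≡ 2 * p * (suc (q * 2) * o) * (suc q * f)
  regroup = solve-∀

legendre-step : ∀ r q {e s} → r < 2 → q ! ≡2^ e *odd → e + s ≡ q →
                ∃[ e′ ] (r + q * 2) ! ≡2^ e′ *odd × e′ + (r + s) ≡ r + q * 2
legendre-step 0 q {e} {s} _ q! e+s≡q with [q*2]!≡2^q*odd*q! q
... | o , odd-o , eq =
  q + e , subst (_≡2^ q + e *odd) (sym eq) (≡2^*odd-* (oddPart o odd-o refl) q!) , (begin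
  q + e + s     ≡⟨ +-assoc q e s ⟩
  q + (e + s)   ≡⟨ cong (q +_) e+s≡q ⟩
  q + q         ≡⟨ cong (q +_) (sym (+-identityʳ q)) ⟩
  2 * q         ≡⟨ *-comm 2 q ⟩
  q * 2         ∎)
  where open ≡-Reasoning
legendre-step 1 q _ q! e+s≡q with legendre-step 0 q (s≤s z≤n) q! e+s≡q
... | e′ , [q*2]! , e′+s≡q*2 =
  e′ , ≡2^*odd-* (odd⇒≡2^0*odd (q , refl)) [q*2]! , trans (+-suc e′ _) (cong suc e′+s≡q*2)
legendre-step (suc (suc _)) _ (s≤s (s≤s ())) _ _

n/2≤f : ∀ {n f} → n ≤ suc f → n / 2 ≤ f
n/2≤f {zero}  _      = z≤n
n/2≤f {suc n} n≤1+f = s≤s⁻¹ (<-≤-trans (m/n<m (suc n) 2 (s≤s (s≤s z≤n))) n≤1+f)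

legendre : ∀ f n → n ≤ f → ∃[ e ] n ! ≡2^ e *odd × e + s₂-fuel f n ≡ n
legendre zero    zero _      = 0 , oddPart 1 (0 , refl) refl , refl
legendre (suc f) n    n≤1+f with legendre f (n / 2) (n/2≤f n≤1+f)
... | e , q! , e+s≡q =
  subst (λ x → ∃[ e′ ] x ! ≡2^ e′ *odd × e′ + (n % 2 + s₂-fuel f (n / 2)) ≡ x)
        (sym (m≡m%n+[m/n]*n n 2))
        (legendre-step (n % 2) (n / 2) (m%n<n n 2) q! e+s≡q)

S*!≡2^*odd : ∀ m → S m * m ! ≡2^ m *odd
S*!≡2^*odd zero    = oddPart 1 (0 , refl) refl
S*!≡2^*odd (suc m) =
  subst (_≡2^ suc m *odd) (sym S[1+m]*[1+m]!≡)
        (≡2^*odd-* (oddPart (3 + 4 * m) (suc (2 * m) , 3+4m≡1+[1+2m]*2 m) refl) (S*!≡2^*odd m))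
  where
  open ≡-Reasoning
  3+4m≡1+[1+2m]*2 : ∀ m → 3 + 4 * m ≡ suc (suc (2 * m) * 2)
  3+4m≡1+[1+2m]*2 = solve-∀
  S[1+m]*[1+m]!≡ : S (suc m) * (suc m * m !) ≡ 2 * (3 + 4 * m) * (S m * m !)
  S[1+m]*[1+m]!≡ = begin
    S (suc m) * (suc m * m !)     ≡⟨ x*[y*z]≡y*x*z (S (suc m)) (suc m) (m !) ⟩
    suc m * S (suc m) * m !       ≡⟨ cong (_* m !) (S-recurrence m) ⟩
    2 * (3 + 4 * m) * S m * m !   ≡⟨ *-assoc (2 * (3 + 4 * m)) (S m) (m !) ⟩
    2 * (3 + 4 * m) * (S m * m !) ∎
    where
    x*[y*z]≡y*x*z : ∀ x y z → x * (y * z) ≡ y * x * z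
    x*[y*z]≡y*x*z = solve-∀

corollary2 : (m : ℕ) → 1 ≤ m →
    Σ ℕ (λ v → Σ ℕ (λ w →
    ν₂≡ (S m) v × ν₂≡ (m !) w × w ≤ m × v ≡ m ∸ w × m ∸ w ≡ s₂ m))
corollary2 m _ with legendre m m ≤-refl
... | w , m!≡ , w+s≡m with ≡2^*odd-factorˡ (S*!≡2^*odd m) m!≡
... | v , Sm≡ , v+w≡m =
  v , w , ≡2^*odd⇒ν₂≡ Sm≡ , ≡2^*odd⇒ν₂≡ m!≡ ,
  subst (w ≤_) w+s≡m (m≤m+n w (s₂ m)) ,
  subst (λ x → v ≡ x ∸ w) v+w≡m (sym (m+n∸n≡m v w)) ,
  subst (λ x → x ∸ w ≡ s₂ m) w+s≡m (m+n∸m≡n w (s₂ m))
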